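{- Let $n\geq 8$ be even. Then there exists an $\mathrm{SH}^*(n;8)$.
   Context: An $\mathrm{H}(n;k)$ is an $n\times n$ partially filled array with entries in $\{\pm1,\dots,\pm nk\}\subset\mathbb{Z}$ such that no two entries agree in absolute value, each row and each column has exactly $k$ filled cells, and every row and every column sums to $0$ in $\mathbb{Z}$. An ordering $(a_1,\dots,a_k)$ is simple modulo $v$ if its partial sums $s_i=\sum_{j\le i}a_j$ are pairwise distinct modulo $v$. An $\mathrm{SH}^*(n;k)$ is an $\mathrm{H}(n;k)$ in which the natural ordering of each row (left to right, skipping empty cells) and each column (top to bottom, skipping empty cells) is simple both modulo $2nk+1$ and modulo $2nk+2$. -}

module Defs where

open import Data.Nat as ℕ using (ℕ; suc; _≤_; _*_)
open import Data.Integer as ℤ using (ℤ; +_; ∣_∣)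
open import Data.Integer.DivMod using (_%ℕ_)
open import Data.Fin using (Fin)
open import Data.Maybe using (Maybe; just; nothing)
open import Data.List using (List; []; _∷_; map; length; foldr; mapMaybe)
open import Data.List.Relation.Unary.Unique.Propositional using (Unique)
open import Data.Fin using (Fin)
open import Data.Vec.Functional using ()
open import Data.List using (allFin) public
open import Data.Product using (_×_; _,_)
open import Relation.Binary.PropositionalEquality using (_≡_; _≢_)

-- A partially filled n×n array with integer entries: nothing = empty cell.
PArray : ℕ → Set
PArray n = Fin n → Fin n → Maybe ℤ

row : ∀ {n} → PArray n → Fin n → List ℤ
row {n} A i = mapMaybe (λ j → A i j) (allFin n)

col : ∀ {n} → PArray n → Fin n → List ℤ
col {n} A j = mapMaybe (λ i → A i j) (allFin n)

sumℤ : List ℤ → ℤ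
sumℤ = foldr ℤ._+_ (+ 0)

partialSums : List ℤ → List ℤ
partialSums [] = []
partialSums (x ∷ xs) = x ∷ map (λ s → x ℤ.+ s) (partialSums xs)

SimpleMod : (v : ℕ) → .{{_ : ℕ.NonZero v}} → List ℤ → Set
SimpleMod v xs = Unique (map (λ s → s %ℕ v) (partialSums xs))

record IsH (n k : ℕ) (A : PArray n) : Set where
  field
    entries   : ∀ i j x → A i j ≡ just x → x ≢ + 0 × ∣ x ∣ ≤ n * k
    absInj    : ∀ i j i' j' x y → A i j ≡ just x → A i' j' ≡ just y →
                ∣ x ∣ ≡ ∣ y ∣ → (i ≡ i' × j ≡ j')
    rowCount  : ∀ i → length (row A i) ≡ k
    colCount  : ∀ j → length (col A j) ≡ k
    rowSum    : ∀ i → sumℤ (row A i) ≡ + 0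
    colSum    : ∀ j → sumℤ (col A j) ≡ + 0

record IsSHstar (n k : ℕ) (A : PArray n) : Set where
  field
    isH        : IsH n k A
    rowSimple₁ : ∀ i → SimpleMod (suc (2 * n * k)) (row A i)
    rowSimple₂ : ∀ i → SimpleMod (suc (suc (2 * n * k))) (row A i)
    colSimple₁ : ∀ j → SimpleMod (suc (2 * n * k)) (col A j)
    colSimple₂ : ∀ j → SimpleMod (suc (suc (2 * n * k))) (col A j)

module Submission where

-- Write n = 2m and cut the n × n array into an m × m grid of 2 × 2 blocks. Block (I, J) is filled
-- exactly when t = (J − I) mod m < 4; its cell (a, b) then holds (−1)^(a+b) (16 I + o) with
-- o = offset t a b from a table that uses each of 1, …, 16 once, so the absolute values are distinct
-- and at most 16m = 8n. Every row and column meets four filled blocks, visiting the four values of t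
-- in a cyclic rotation of 0,1,2,3 (rows) or of 3,2,1,0 (columns). Such a line reads ±(x₁, −y₁, x₂, −y₂, …)
-- with xᵢ = 16Bᵢ + pᵢ and yᵢ = 16Bᵢ + qᵢ, so its partial sums are ±(16Bᵢ + cᵢ) inside the i-th block and
-- ±eᵢ after it, where the cᵢ and eᵢ depend on the offsets alone. A finite check over all rotations shows
-- that the eᵢ end at 0, are distinct and lie below every cᵢ, and that the cᵢ are distinct modulo 16.
-- Hence the partial sums are distinct integers in a window of width 16m + 40 < 2nk + 1, and so they are
-- distinct modulo 2nk + 1 and modulo 2nk + 2.

open import Defs

module CyclicWindows where

  open import Data.Nat as ℕ using (ℕ; zero; suc; _+_; _*_; _∸_; _⊓_; _≤_; _<_; z≤n; s≤s; NonZero)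
  import Data.Nat.Properties as ℕ
  open import Data.Nat.DivMod using (_%_; [m+n]%n≡m%n; m<n⇒m%n≡m)
  open import Data.Fin using (toℕ)
  open import Data.List
    using (List; []; _∷_; _++_; map; concat; concatMap; mapMaybe; fromMaybe; applyUpTo; upTo; tabulate; allFin; length)
  open import Data.List.Properties
    using (++-assoc; concat-++; concatMap-++; map-applyUpTo; map-tabulate; mapMaybe-concatMap; length-++; length-applyUpTo; length-upTo)
  open import Data.Maybe using (Maybe)
  open import Data.Product using (Σ-syntax; _×_; _,_)
  open import Data.Sum using ([_,_]′)
  open import Function using (_∘_; id)
  open import Relation.Binary.PropositionalEquality

  private variable
    A : Set

  applyUpTo-+ : ∀ (f : ℕ → A) m n → applyUpTo f (m + n) ≡ applyUpTo f m ++ applyUpTo (f ∘ (m +_)) n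
  applyUpTo-+ f zero    n = refl
  applyUpTo-+ f (suc m) n = cong (f 0 ∷_) (applyUpTo-+ (f ∘ suc) m n)

  applyUpTo-cong : ∀ {f g : ℕ → A} n → (∀ {i} → i < n → f i ≡ g i) → applyUpTo f n ≡ applyUpTo g n
  applyUpTo-cong zero    eq = refl
  applyUpTo-cong (suc n) eq = cong₂ _∷_ (eq (s≤s z≤n)) (applyUpTo-cong n (eq ∘ s≤s))

  tabulate-toℕ : ∀ (h : ℕ → A) n → tabulate {n = n} (h ∘ toℕ) ≡ applyUpTo h n
  tabulate-toℕ h zero    = refl
  tabulate-toℕ h (suc n) = cong (h 0 ∷_) (tabulate-toℕ (h ∘ suc) n)

  mapMaybe-allFin : ∀ (h : ℕ → Maybe A) n → mapMaybe (h ∘ toℕ) (allFin n) ≡ concat (applyUpTo (fromMaybe ∘ h) n)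
  mapMaybe-allFin h n = begin
    mapMaybe (h ∘ toℕ) (allFin n)
      ≡⟨ mapMaybe-concatMap (h ∘ toℕ) (allFin n) ⟩
    concat (map (fromMaybe ∘ h ∘ toℕ) (tabulate {n = n} id))
      ≡⟨ cong concat (map-tabulate {n = n} id (fromMaybe ∘ h ∘ toℕ)) ⟩
    concat (tabulate {n = n} (fromMaybe ∘ h ∘ toℕ))
      ≡⟨ cong concat (tabulate-toℕ (fromMaybe ∘ h) n) ⟩
    concat (applyUpTo (fromMaybe ∘ h) n) ∎
    where open ≡-Reasoning

  concat-applyUpTo-*2 : ∀ (h : ℕ → List A) m →
    concat (applyUpTo h (m * 2)) ≡ concat (applyUpTo (λ j → h (j * 2) ++ h (suc (j * 2))) m)
  concat-applyUpTo-*2 h zero    = refl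
  concat-applyUpTo-*2 h (suc m) = begin
    h 0 ++ (h 1 ++ concat (applyUpTo (h ∘ suc ∘ suc) (m * 2)))
      ≡⟨ sym (++-assoc (h 0) (h 1) _) ⟩
    (h 0 ++ h 1) ++ concat (applyUpTo (h ∘ suc ∘ suc) (m * 2))
      ≡⟨ cong ((h 0 ++ h 1) ++_) (concat-applyUpTo-*2 (h ∘ suc ∘ suc) m) ⟩
    (h 0 ++ h 1) ++ concat (applyUpTo (λ j → h (suc (suc (j * 2))) ++ h (suc (suc (suc (j * 2))))) m) ∎
    where open ≡-Reasoning

  concat-applyUpTo-[] : ∀ (h : ℕ → List A) n → (∀ {i} → i < n → h i ≡ []) → concat (applyUpTo h n) ≡ []
  concat-applyUpTo-[] h zero    vanish = refl
  concat-applyUpTo-[] h (suc n) vanish =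
    cong₂ _++_ (vanish (s≤s z≤n)) (concat-applyUpTo-[] (h ∘ suc) n (vanish ∘ s≤s))

  concat-applyUpTo-⊓ : ∀ (h : ℕ → List A) w n → (∀ {i} → w ≤ i → i < n → h i ≡ []) →
    concat (applyUpTo h n) ≡ concat (applyUpTo h (n ⊓ w))
  concat-applyUpTo-⊓ h w       zero    vanish = refl
  concat-applyUpTo-⊓ h zero    (suc n) vanish = concat-applyUpTo-[] h (suc n) (vanish z≤n)
  concat-applyUpTo-⊓ h (suc w) (suc n) vanish =
    cong (h 0 ++_) (concat-applyUpTo-⊓ (h ∘ suc) w n (λ w≤i i<n → vanish (s≤s w≤i) (s≤s i<n)))

  rotate : ℕ → ℕ → List ℕ
  rotate w k = applyUpTo (k +_) (w ∸ k) ++ upTo k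

  length-rotate : ∀ {w k} → k ≤ w → length (rotate w k) ≡ w
  length-rotate {w} {k} k≤w = begin
    length (rotate w k)                                    ≡⟨ length-++ (applyUpTo (k +_) (w ∸ k)) ⟩
    length (applyUpTo (k +_) (w ∸ k)) + length (upTo k)    ≡⟨ cong₂ _+_ (length-applyUpTo (k +_) (w ∸ k)) (length-upTo k) ⟩
    w ∸ k + k                                              ≡⟨ ℕ.m∸n+n≡m k≤w ⟩
    w                                                      ∎
    where open ≡-Reasoning

  concatMap-rotate : ∀ (g : ℕ → List A) w k →
    concatMap g (rotate w k) ≡ concat (applyUpTo (g ∘ (k +_)) (w ∸ k)) ++ concat (applyUpTo g k)
  concatMap-rotate g w k = trans (concatMap-++ g (applyUpTo (k +_) (w ∸ k)) (upTo k))
    (cong₂ _++_ (cong concat (map-applyUpTo (k +_) g (w ∸ k))) (cong concat (map-applyUpTo id g k)))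

  module _ {m : ℕ} .{{_ : NonZero m}} where

    applyUpTo-cyclic : ∀ (f : ℕ → A) s → s ≤ m →
      applyUpTo f m ≡ applyUpTo (λ i → f ((s + (m ∸ s + i)) % m)) s ++ applyUpTo (λ i → f ((s + i) % m)) (m ∸ s)
    applyUpTo-cyclic f s s≤m = begin
      applyUpTo f m                                    ≡⟨ cong (applyUpTo f) (sym (ℕ.m+[n∸m]≡n s≤m)) ⟩
      applyUpTo f (s + (m ∸ s))                        ≡⟨ applyUpTo-+ f s (m ∸ s) ⟩
      applyUpTo f s ++ applyUpTo (f ∘ (s +_)) (m ∸ s)  ≡⟨ cong₂ _++_ (applyUpTo-cong s (cong f ∘ wrapped))
                                                                     (applyUpTo-cong (m ∸ s) (cong f ∘ unwrapped)) ⟩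
      applyUpTo (λ i → f ((s + (m ∸ s + i)) % m)) s ++ applyUpTo (λ i → f ((s + i) % m)) (m ∸ s) ∎
      where
      open ≡-Reasoning
      wrapped : ∀ {i} → i < s → i ≡ (s + (m ∸ s + i)) % m
      wrapped {i} i<s = begin
        i                      ≡⟨ sym (m<n⇒m%n≡m (ℕ.<-≤-trans i<s s≤m)) ⟩
        i % m                  ≡⟨ sym ([m+n]%n≡m%n i m) ⟩
        (i + m) % m            ≡⟨ cong (_% m) (trans (ℕ.+-comm i m) (cong (_+ i) (sym (ℕ.m+[n∸m]≡n s≤m)))) ⟩
        (s + (m ∸ s) + i) % m  ≡⟨ cong (_% m) (ℕ.+-assoc s (m ∸ s) i) ⟩
        (s + (m ∸ s + i)) % m  ∎
      unwrapped : ∀ {i} → i < m ∸ s → s + i ≡ (s + i) % m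
      unwrapped {i} i<m∸s = sym (m<n⇒m%n≡m (subst (s + i <_) (ℕ.m+[n∸m]≡n s≤m) (ℕ.+-monoʳ-< s i<m∸s)))

    window : ∀ w s (f g : ℕ → List A) → w ≤ m → s ≤ m →
      (∀ {u} → w ≤ u → u < m → f ((s + u) % m) ≡ []) →
      (∀ {u} → u < w → f ((s + u) % m) ≡ g u) →
      Σ[ k ∈ ℕ ] k ≤ w × concat (applyUpTo f m) ≡ concatMap g (rotate w k)
    window w s f g w≤m s≤m outside inside =
      [ (λ d≤w → d , d≤w , short d≤w) , (λ w<d → w , ℕ.≤-refl , long w<d) ]′ (ℕ.≤-<-connex d w)
      where
      open ≡-Reasoning
      d = m ∸ s
      h = λ u → f ((s + u) % m)
      m≡d+s : m ≡ d + s
      m≡d+s = sym (ℕ.m∸n+n≡m s≤m)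
      d+i<m : ∀ {i} → i < s → d + i < m
      d+i<m {i} i<s = subst (d + i <_) (sym m≡d+s) (ℕ.+-monoʳ-< d i<s)
      split : concat (applyUpTo f m) ≡ concat (applyUpTo (h ∘ (d +_)) s) ++ concat (applyUpTo h d)
      split = trans (cong concat (applyUpTo-cyclic f s s≤m)) (sym (concat-++ (applyUpTo (h ∘ (d +_)) s) (applyUpTo h d)))
      short : d ≤ w → concat (applyUpTo f m) ≡ concatMap g (rotate w d)
      short d≤w = begin
        concat (applyUpTo f m)
          ≡⟨ split ⟩
        concat (applyUpTo (h ∘ (d +_)) s) ++ concat (applyUpTo h d)
          ≡⟨ cong (_++ concat (applyUpTo h d)) tail-vanishes ⟩
        concat (applyUpTo (h ∘ (d +_)) (s ⊓ (w ∸ d))) ++ concat (applyUpTo h d)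
          ≡⟨ cong (λ k → concat (applyUpTo (h ∘ (d +_)) k) ++ concat (applyUpTo h d)) (ℕ.m≥n⇒m⊓n≡n w∸d≤s) ⟩
        concat (applyUpTo (h ∘ (d +_)) (w ∸ d)) ++ concat (applyUpTo h d)
          ≡⟨ cong₂ (λ xs ys → concat xs ++ concat ys)
               (applyUpTo-cong (w ∸ d) (inside ∘ d+i<w)) (applyUpTo-cong d (λ i<d → inside (ℕ.<-≤-trans i<d d≤w))) ⟩
        concat (applyUpTo (g ∘ (d +_)) (w ∸ d)) ++ concat (applyUpTo g d)
          ≡⟨ concatMap-rotate g w d ⟨
        concatMap g (rotate w d) ∎
        where
        tail-vanishes : concat (applyUpTo (h ∘ (d +_)) s) ≡ concat (applyUpTo (h ∘ (d +_)) (s ⊓ (w ∸ d)))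
        tail-vanishes = concat-applyUpTo-⊓ (h ∘ (d +_)) (w ∸ d) s
          (λ w∸d≤i i<s → outside (ℕ.≤-trans (ℕ.m≤n+m∸n w d) (ℕ.+-monoʳ-≤ d w∸d≤i)) (d+i<m i<s))
        w∸d≤s : w ∸ d ≤ s
        w∸d≤s = ℕ.m≤n+o⇒m∸n≤o w d (subst (w ≤_) m≡d+s w≤m)
        d+i<w : ∀ {i} → i < w ∸ d → d + i < w
        d+i<w {i} i<w∸d = subst (_≤ w) (cong suc (ℕ.+-comm i d)) (ℕ.m≤o∸n⇒m+n≤o (suc i) d≤w i<w∸d)
      long : w < d → concat (applyUpTo f m) ≡ concatMap g (rotate w w)
      long w<d = begin
        concat (applyUpTo f m)
          ≡⟨ split ⟩
        concat (applyUpTo (h ∘ (d +_)) s) ++ concat (applyUpTo h d)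
          ≡⟨ cong₂ _++_
               (concat-applyUpTo-[] (h ∘ (d +_)) s (λ i<s → outside (ℕ.≤-trans (ℕ.<⇒≤ w<d) (ℕ.m≤m+n d _)) (d+i<m i<s)))
               (concat-applyUpTo-⊓ h w d (λ w≤i i<d → outside w≤i (ℕ.<-≤-trans i<d (ℕ.m∸n≤m m s)))) ⟩
        concat (applyUpTo h (d ⊓ w))
          ≡⟨ cong (concat ∘ applyUpTo h) (ℕ.m≥n⇒m⊓n≡n (ℕ.<⇒≤ w<d)) ⟩
        concat (applyUpTo h w)
          ≡⟨ cong concat (applyUpTo-cong w inside) ⟩
        concat (applyUpTo g w)
          ≡⟨ cong (λ k → concat (applyUpTo (g ∘ (w +_)) k) ++ concat (applyUpTo g w)) (sym (ℕ.n∸n≡0 w)) ⟩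
        concat (applyUpTo (g ∘ (w +_)) (w ∸ w)) ++ concat (applyUpTo g w)
          ≡⟨ concatMap-rotate g w w ⟨
        concatMap g (rotate w w) ∎

module Residues where

  open import Data.Nat as ℕ using (ℕ; zero; suc; _∸_; _<_; _≤_; NonZero)
  import Data.Nat.Properties as ℕ
  import Data.Nat.Divisibility as ℕ
  open import Data.Nat.DivMod
    using (_%_; _/_; m%n%n≡m%n; m<n⇒m%n≡m; %-distribˡ-+; +-distrib-/; m<n⇒m/n≡0; m*n/n≡m; m*n%n≡0; [m+kn]%n≡m%n; m≡m%n+[m/n]*n)
  open import Data.Integer as ℤ using (ℤ; +_; _+_; _-_; _*_; -_; ∣_∣)
  import Data.Integer.Properties as ℤ
  open import Data.Integer.DivMod using (_%ℕ_; _/ℕ_; a≡a%ℕn+[a/ℕn]*n; n%ℕd<d)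
  open import Data.Integer.Divisibility.Signed using (_∣_; divides; ∣⇒∣ᵤ; ∣m∣n⇒∣m-n; ∣n⇒∣m*n; ∣m⇒∣-m; ∣-refl)
  open import Data.Integer.Tactic.RingSolver using (solve-∀)
  open import Data.List using (map)
  open import Data.List.Relation.Unary.AllPairs as AllPairs using (AllPairs)
  import Data.List.Relation.Unary.AllPairs.Properties as AllPairs
  open import Data.Product using (_×_; _,_)
  open import Function using (_∘_)
  open import Relation.Binary.PropositionalEquality
  open import Relation.Nullary using (contradiction)

  infix 4 _≡_mod_

  _≡_mod_ : ℤ → ℤ → ℕ → Set
  x ≡ y mod m = + m ∣ x - y

  ∣∧<⇒≡0 : ∀ {m n} → m ℕ.∣ n → n < m → n ≡ 0
  ∣∧<⇒≡0 (ℕ.divides zero    refl) _  = refl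
  ∣∧<⇒≡0 (ℕ.divides (suc q) refl) lt = contradiction lt (ℕ.≤⇒≯ (ℕ.m≤m+n _ _))

  ∣+a-+b∣<n : ∀ {a b n} → a < n → b < n → ∣ + a - + b ∣ < n
  ∣+a-+b∣<n {a} {b} a<n b<n = ℕ.≤-<-trans (ℕ.≤-reflexive (cong ∣_∣ (ℤ.[+m]-[+n]≡m⊖n a b)))
                                (ℕ.≤-<-trans (ℤ.∣m⊝n∣≤m⊔n a b) (ℕ.⊔-lub a<n b<n))

  ≡mod∧close⇒≡ : ∀ {m x y} → x ≡ y mod m → ∣ x - y ∣ < m → x ≡ y
  ≡mod∧close⇒≡ {x = x} {y} x≡y close = ℤ.i-j≡0⇒i≡j x y (ℤ.∣i∣≡0⇒i≡0 (∣∧<⇒≡0 (∣⇒∣ᵤ x≡y) close))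

  ≡mod-− : ∀ {m a a′ b b′} → a ≡ a′ mod m → b ≡ b′ mod m → a - b ≡ a′ - b′ mod m
  ≡mod-− {a = a} {a′} {b} {b′} a≡a′ b≡b′ = subst (_ ∣_) (regroup a a′ b b′) (∣m∣n⇒∣m-n a≡a′ b≡b′)
    where
    regroup : ∀ a a′ b b′ → (a - a′) - (b - b′) ≡ (a - b) - (a′ - b′)
    regroup = solve-∀

  module _ {m : ℕ} .{{_ : NonZero m}} where

    %ℕ-≡⇒≡mod : ∀ x y → x %ℕ m ≡ y %ℕ m → x ≡ y mod m
    %ℕ-≡⇒≡mod x y eq = divides (x /ℕ m - y /ℕ m) (begin
      x - y
        ≡⟨ cong₂ _-_ (a≡a%ℕn+[a/ℕn]*n x m)
                     (trans (a≡a%ℕn+[a/ℕn]*n y m) (cong (λ r → + r + y /ℕ m * + m) (sym eq))) ⟩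
      (+ (x %ℕ m) + x /ℕ m * + m) - (+ (x %ℕ m) + y /ℕ m * + m)
        ≡⟨ cancel (+ (x %ℕ m)) (x /ℕ m) (y /ℕ m) (+ m) ⟩
      (x /ℕ m - y /ℕ m) * + m ∎)
      where
      open ≡-Reasoning
      cancel : ∀ r a b k → (r + a * k) - (r + b * k) ≡ (a - b) * k
      cancel = solve-∀

    ≡mod⇒%ℕ-≡ : ∀ {x y} → x ≡ y mod m → x %ℕ m ≡ y %ℕ m
    ≡mod⇒%ℕ-≡ {x} {y} x≡y = ℤ.+-injective (≡mod∧close⇒≡ residues≡ close)
      where
      rx = x %ℕ m
      ry = y %ℕ m
      cancel : ∀ r s a b k → ((r + a * k) - (s + b * k)) - (a - b) * k ≡ r - s
      cancel = solve-∀
      difference : (x - y) - (x /ℕ m - y /ℕ m) * + m ≡ + rx - + ry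
      difference = trans
        (cong₂ (λ u v → (u - v) - (x /ℕ m - y /ℕ m) * + m) (a≡a%ℕn+[a/ℕn]*n x m) (a≡a%ℕn+[a/ℕn]*n y m))
        (cancel (+ rx) (+ ry) (x /ℕ m) (y /ℕ m) (+ m))
      residues≡ : + rx ≡ + ry mod m
      residues≡ = subst (+ m ∣_) difference (∣m∣n⇒∣m-n x≡y (∣n⇒∣m*n (x /ℕ m - y /ℕ m) ∣-refl))
      close : ∣ + rx - + ry ∣ < m
      close = ∣+a-+b∣<n (n%ℕd<d x m) (n%ℕd<d y m)

    %ℕ-≡∧close⇒≡ : ∀ {x y} → ∣ x - y ∣ < m → x %ℕ m ≡ y %ℕ m → x ≡ y
    %ℕ-≡∧close⇒≡ {x} {y} close eq = ≡mod∧close⇒≡ (%ℕ-≡⇒≡mod x y eq) close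

    residues-unique : ∀ {xs} → AllPairs (λ x y → x ≢ y × ∣ x - y ∣ < m) xs →
      AllPairs _≢_ (map (_%ℕ m) xs)
    residues-unique = AllPairs.map⁺ ∘ AllPairs.map (λ (x≢y , close) → x≢y ∘ %ℕ-≡∧close⇒≡ close)

    n%m≡n-mod : ∀ n → + (n % m) ≡ + n mod m
    n%m≡n-mod n = %ℕ-≡⇒≡mod (+ (n % m)) (+ n) (m%n%n≡m%n n m)

    [a%m-b%m]%m≡[a-b]%m : ∀ a b → (+ (a % m) - + (b % m)) %ℕ m ≡ (+ a - + b) %ℕ m
    [a%m-b%m]%m≡[a-b]%m a b = ≡mod⇒%ℕ-≡ {+ (a % m) - + (b % m)} {+ a - + b}
      (≡mod-− {a = + (a % m)} {+ a} {+ (b % m)} {+ b} (n%m≡n-mod a) (n%m≡n-mod b))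

    b≤a⇒[a-b]%m≡a∸b : ∀ {a b} → b ≤ a → a < m → (+ a - + b) %ℕ m ≡ a ∸ b
    b≤a⇒[a-b]%m≡a∸b {a} {b} b≤a a<m = begin
      (+ a - + b) %ℕ m   ≡⟨ cong (_%ℕ m) (trans (ℤ.[+m]-[+n]≡m⊖n a b) (ℤ.⊖-≥ b≤a)) ⟩
      (a ∸ b) % m        ≡⟨ m<n⇒m%n≡m (ℕ.≤-<-trans (ℕ.m∸n≤m a b) a<m) ⟩
      a ∸ b              ∎
      where open ≡-Reasoning

    a<b⇒[a-b]%m≡a+m∸b : ∀ {a b} → a < b → b < m → (+ a - + b) %ℕ m ≡ a ℕ.+ m ∸ b
    a<b⇒[a-b]%m≡a+m∸b {a} {b} a<b b<m = begin
      (+ a - + b) %ℕ m     ≡⟨ ≡mod⇒%ℕ-≡ {+ a - + b} {+ (a ℕ.+ m ∸ b)} (subst (_ ∣_) wrap (∣m⇒∣-m ∣-refl)) ⟩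
      (a ℕ.+ m ∸ b) % m    ≡⟨ m<n⇒m%n≡m (ℕ.m<n+o⇒m∸n<o (a ℕ.+ m) b (ℕ.+-monoˡ-< m a<b)) ⟩
      a ℕ.+ m ∸ b          ∎
      where
      open ≡-Reasoning
      b≤a+m : b ℕ.≤ a ℕ.+ m
      b≤a+m = ℕ.≤-trans (ℕ.<⇒≤ b<m) (ℕ.m≤n+m m a)
      regroup : ∀ a b k → - k ≡ (a - b) - ((a + k) - b)
      regroup = solve-∀
      wrap : - + m ≡ (+ a - + b) - + (a ℕ.+ m ∸ b)
      wrap = begin
        - + m                                 ≡⟨ regroup (+ a) (+ b) (+ m) ⟩
        (+ a - + b) - ((+ a + + m) - + b)     ≡⟨ cong (λ z → (+ a - + b) - (z - + b)) (sym (ℤ.pos-+ a m)) ⟩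
        (+ a - + b) - (+ (a ℕ.+ m) - + b)     ≡⟨ cong (λ z → (+ a - + b) - z)
                                                   (trans (ℤ.[+m]-[+n]≡m⊖n (a ℕ.+ m) b) (ℤ.⊖-≥ b≤a+m)) ⟩
        (+ a - + b) - + (a ℕ.+ m ∸ b)         ∎

  [m%d+n]%d≡[m+n]%d : ∀ a b d .{{_ : NonZero d}} → (a % d ℕ.+ b) % d ≡ (a ℕ.+ b) % d
  [m%d+n]%d≡[m+n]%d a b d = begin
    (a % d ℕ.+ b) % d               ≡⟨ %-distribˡ-+ (a % d) b d ⟩
    (a % d % d ℕ.+ b % d) % d       ≡⟨ cong (λ r → (r ℕ.+ b % d) % d) (m%n%n≡m%n a d) ⟩
    (a % d ℕ.+ b % d) % d           ≡⟨ sym (%-distribˡ-+ a b d) ⟩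
    (a ℕ.+ b) % d                   ∎
    where open ≡-Reasoning

  module _ {n : ℕ} .{{_ : NonZero n}} where

    [a+I*n]/n≡I : ∀ {a} I → a < n → (a ℕ.+ I ℕ.* n) / n ≡ I
    [a+I*n]/n≡I {a} I a<n = begin
      (a ℕ.+ I ℕ.* n) / n        ≡⟨ +-distrib-/ a (I ℕ.* n) (subst (_< n) (sym a%n+[I*n]%n≡a) a<n) ⟩
      a / n ℕ.+ I ℕ.* n / n      ≡⟨ cong₂ ℕ._+_ (m<n⇒m/n≡0 a<n) (m*n/n≡m I n) ⟩
      I                          ∎
      where
      open ≡-Reasoning
      a%n+[I*n]%n≡a : a % n ℕ.+ I ℕ.* n % n ≡ a
      a%n+[I*n]%n≡a = trans (cong₂ ℕ._+_ (m<n⇒m%n≡m a<n) (m*n%n≡0 I n)) (ℕ.+-identityʳ a)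

    [a+I*n]%n≡a : ∀ {a} I → a < n → (a ℕ.+ I ℕ.* n) % n ≡ a
    [a+I*n]%n≡a {a} I a<n = trans ([m+kn]%n≡m%n a I n) (m<n⇒m%n≡m a<n)

    %-/-injective : ∀ {c c′} → c % n ≡ c′ % n → c / n ≡ c′ / n → c ≡ c′
    %-/-injective {c} {c′} r≡r′ q≡q′ =
      trans (m≡m%n+[m/n]*n c n) (trans (cong₂ (λ r q → r ℕ.+ q ℕ.* n) r≡r′ q≡q′) (sym (m≡m%n+[m/n]*n c′ n)))

module BlockLines where

  open import Data.Bool using (Bool; true; false; not)
  open import Data.Nat as ℕ using (ℕ; suc; NonZero)
  import Data.Nat.Properties as ℕ
  open import Data.Integer as ℤ using (ℤ; +_; _+_; _-_; -_; ∣_∣; _≤_; _<_; _⊖_)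
  import Data.Integer.Properties as ℤ
  open import Data.Integer.Divisibility.Signed using (divides)
  open import Data.Integer.Tactic.RingSolver using (solve-∀)
  open import Data.List using (List; []; _∷_; map; concatMap; length)
  open import Data.List.Properties using (map-∘; map-cong; map-id)
  open import Data.List.Relation.Unary.All as All using (All; []; _∷_; all?)
  open import Data.List.Relation.Unary.AllPairs as AllPairs using (AllPairs; []; _∷_; allPairs?)
  import Data.List.Relation.Unary.AllPairs.Properties as AllPairs
  open import Data.Product using (Σ-syntax; _×_; _,_)
  open import Data.Unit using (⊤; tt)
  open import Function using (_∘_)
  open import Relation.Binary using (Decidable)
  open import Relation.Binary.PropositionalEquality
  open import Relation.Nullary using (Dec; ¬?; _×-dec_)

  open Residues

  signed : Bool → ℤ → ℤ
  signed true  x = x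
  signed false x = - x

  record Block : Set where
    constructor block
    field
      base rise fall : ℕ

  pair : Bool → Block → List ℤ
  pair σ (block B p q) = signed σ (+ (B ℕ.* 16 ℕ.+ p)) ∷ signed (not σ) (+ (B ℕ.* 16 ℕ.+ q)) ∷ []

  line : Bool → List Block → List ℤ
  line σ = concatMap (pair σ)

  drift : List Block → ℤ
  drift []                 = + 0
  drift (block _ p q ∷ bs) = (+ p - + q) + drift bs

  data Mark : Set where
    mid : ℕ → ℤ → Mark
    end : ℤ → Mark

  value : Mark → ℤ
  value (mid B c) = + (B ℕ.* 16) + c
  value (end e)   = e

  marks : ℤ → List Block → List Mark
  marks E []                 = []
  marks E (block B p q ∷ bs) = mid B (E + + p) ∷ end (E + + p - + q) ∷ marks (E + + p - + q) bs

  signed-0 : ∀ σ → signed σ (+ 0) ≡ + 0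
  signed-0 true  = refl
  signed-0 false = refl

  signed-+ : ∀ σ x y → signed σ x + signed σ y ≡ signed σ (x + y)
  signed-+ true  x y = refl
  signed-+ false x y = sym (ℤ.neg-distrib-+ x y)

  pair-sum : ∀ σ N p q → signed σ (+ (N ℕ.+ p)) + signed (not σ) (+ (N ℕ.+ q)) ≡ signed σ (+ p - + q)
  pair-sum σ N p q rewrite ℤ.pos-+ N p | ℤ.pos-+ N q with σ
  ... | true  = cancel (+ N) (+ p) (+ q)
    where
    cancel : ∀ n p q → n + p + - (n + q) ≡ p - q
    cancel = solve-∀
  ... | false = cancel (+ N) (+ p) (+ q)
    where
    cancel : ∀ n p q → - (n + p) + (n + q) ≡ - (p - q)
    cancel = solve-∀

  length-line : ∀ σ bs → length (line σ bs) ≡ length bs ℕ.* 2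
  length-line σ []                 = refl
  length-line σ (block _ _ _ ∷ bs) = cong (suc ∘ suc) (length-line σ bs)

  sum-line : ∀ σ bs → sumℤ (line σ bs) ≡ signed σ (drift bs)
  sum-line true  []                 = refl
  sum-line false []                 = refl
  sum-line σ     (block B p q ∷ bs) = begin
    x + (y + sumℤ (line σ bs))          ≡⟨ sym (ℤ.+-assoc x y _) ⟩
    (x + y) + sumℤ (line σ bs)          ≡⟨ cong₂ _+_ (pair-sum σ (B ℕ.* 16) p q) (sum-line σ bs) ⟩
    signed σ (+ p - + q) + signed σ (drift bs) ≡⟨ signed-+ σ _ _ ⟩
    signed σ (drift (block B p q ∷ bs)) ∎
    where
    open ≡-Reasoning
    x = signed σ (+ (B ℕ.* 16 ℕ.+ p))
    y = signed (not σ) (+ (B ℕ.* 16 ℕ.+ q))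

  partialSums-line-from : ∀ σ E bs →
    map (_+_ (signed σ E)) (partialSums (line σ bs)) ≡ map (signed σ ∘ value) (marks E bs)
  partialSums-line-from σ E []                 = refl
  partialSums-line-from σ E (block B p q ∷ bs) =
    cong₂ _∷_ first (cong₂ _∷_ second (trans rest (partialSums-line-from σ E′ bs)))
    where
    x = signed σ (+ (B ℕ.* 16 ℕ.+ p))
    y = signed (not σ) (+ (B ℕ.* 16 ℕ.+ q))
    E′ = E + + p - + q
    P = partialSums (line σ bs)
    first : signed σ E + x ≡ signed σ (+ (B ℕ.* 16) + (E + + p))
    first = trans (signed-+ σ E _)
      (cong (signed σ) (trans (cong (_+_ E) (ℤ.pos-+ (B ℕ.* 16) p)) (swap E (+ (B ℕ.* 16)) (+ p))))
      where
      swap : ∀ e n p → e + (n + p) ≡ n + (e + p)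
      swap = solve-∀
    second : signed σ E + (x + y) ≡ signed σ E′
    second = trans (cong (_+_ (signed σ E)) (pair-sum σ (B ℕ.* 16) p q))
                   (trans (signed-+ σ E _) (cong (signed σ) (sym (ℤ.+-assoc E (+ p) (- + q)))))
    rest : map (_+_ (signed σ E)) (map (_+_ x) (map (_+_ y) P)) ≡ map (_+_ (signed σ E′)) P
    rest = begin
      map (_+_ (signed σ E)) (map (_+_ x) (map (_+_ y) P))
        ≡⟨ sym (trans (map-∘ P) (map-∘ (map (_+_ y) P))) ⟩
      map (λ z → signed σ E + (x + (y + z))) P
        ≡⟨ map-cong (λ z → trans (regroup (signed σ E) x y z) (cong (_+ z) second)) P ⟩
      map (_+_ (signed σ E′)) P ∎
      where
      open ≡-Reasoning
      regroup : ∀ e x y z → e + (x + (y + z)) ≡ (e + (x + y)) + z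
      regroup = solve-∀

  partialSums-line : ∀ σ bs → partialSums (line σ bs) ≡ map (signed σ ∘ value) (marks (+ 0) bs)
  partialSums-line σ bs = trans (sym unshifted) (partialSums-line-from σ (+ 0) bs)
    where
    ps = partialSums (line σ bs)
    unshifted : map (_+_ (signed σ (+ 0))) ps ≡ ps
    unshifted = trans (cong (λ e → map (_+_ e) ps) (signed-0 σ)) (trans (map-cong ℤ.+-identityˡ ps) (map-id ps))

  Apart : Mark → Mark → Set
  Apart (mid _ c) (mid _ c′) = c ≢ c′ × ∣ c - c′ ∣ ℕ.< 16
  Apart (mid _ c) (end e)    = e < c
  Apart (end e)   (mid _ c)  = e < c
  Apart (end e)   (end e′)   = e ≢ e′

  apart? : Decidable Apart
  apart? (mid _ c) (mid _ c′) = ¬? (c ℤ.≟ c′) ×-dec (∣ c - c′ ∣ ℕ.<? 16)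
  apart? (mid _ c) (end e)    = e ℤ.<? c
  apart? (end e)   (mid _ c)  = e ℤ.<? c
  apart? (end e)   (end e′)   = ¬? (e ℤ.≟ e′)

  mid-value-≡⇒≡mod16 : ∀ {B B′ c c′} → value (mid B c) ≡ value (mid B′ c′) → c ≡ c′ mod 16
  mid-value-≡⇒≡mod16 {B} {B′} {c} {c′} eq = divides (+ B′ - + B) (begin
    c - c′                                          ≡⟨ regroup (+ (B ℕ.* 16)) c c′ ⟩
    ((+ (B ℕ.* 16) + c) - c′) - + (B ℕ.* 16)        ≡⟨ cong (λ z → (z - c′) - + (B ℕ.* 16)) eq ⟩
    ((+ (B′ ℕ.* 16) + c′) - c′) - + (B ℕ.* 16)      ≡⟨ cong₂ (λ u v → ((u + c′) - c′) - v) (ℤ.pos-* B′ 16) (ℤ.pos-* B 16) ⟩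
    ((+ B′ ℤ.* + 16 + c′) - c′) - + B ℤ.* + 16      ≡⟨ factor (+ B′) (+ B) c′ ⟩
    (+ B′ - + B) ℤ.* + 16                           ∎)
    where
    open ≡-Reasoning
    regroup : ∀ n c c′ → c - c′ ≡ ((n + c) - c′) - n
    regroup = solve-∀
    factor : ∀ b′ b c′ → ((b′ ℤ.* + 16 + c′) - c′) - b ℤ.* + 16 ≡ (b′ - b) ℤ.* + 16
    factor = solve-∀

  apart⇒value≢ : ∀ x y → Apart x y → value x ≢ value y
  apart⇒value≢ (mid B c) (mid B′ c′) (c≢c′ , close) eq =
    c≢c′ (≡mod∧close⇒≡ {x = c} {c′} (mid-value-≡⇒≡mod16 {B} {B′} {c} {c′} eq) close)
  apart⇒value≢ (mid B c) (end e)   e<c eq = ℤ.<-irrefl (sym eq) (ℤ.<-≤-trans e<c (ℤ.i≤j+i c (+ (B ℕ.* 16))))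
  apart⇒value≢ (end e)   (mid B c) e<c eq = ℤ.<-irrefl eq (ℤ.<-≤-trans e<c (ℤ.i≤j+i c (+ (B ℕ.* 16))))
  apart⇒value≢ (end e)   (end e′)  e≢e′   = e≢e′

  Bounded : ℤ → Set
  Bounded z = + 0 ≤ z + + 20 × z + + 20 ≤ + 40

  Small : Mark → Set
  Small (mid _ c) = Bounded c
  Small (end e)   = Bounded e

  bounded? : ∀ z → Dec (Bounded z)
  bounded? z = (+ 0 ℤ.≤? z + + 20) ×-dec (z + + 20 ℤ.≤? + 40)

  small? : ∀ x → Dec (Small x)
  small? (mid _ c) = bounded? c
  small? (end e)   = bounded? e

  Within : ℕ → ℤ → Set
  Within W x = Σ[ N ∈ ℕ ] x + + 20 ≡ + N × N ℕ.≤ W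

  bounded⇒within : ∀ {z} → Bounded z → Within 40 z
  bounded⇒within (0≤z+20 , z+20≤40) =
    _ , sym (ℤ.0≤i⇒+∣i∣≡i 0≤z+20) , ℤ.drop‿+≤+ (subst (_≤ + 40) (sym (ℤ.0≤i⇒+∣i∣≡i 0≤z+20)) z+20≤40)

  within-close : ∀ {W x y} → Within W x → Within W y → ∣ x - y ∣ ℕ.≤ W
  within-close {W} {x} {y} (N , x+20≡N , N≤W) (M , y+20≡M , M≤W) = begin
    ∣ x - y ∣                       ≡⟨ cong ∣_∣ (shift x y (+ 20)) ⟩
    ∣ (x + + 20) - (y + + 20) ∣     ≡⟨ cong ∣_∣ (trans (cong₂ _-_ x+20≡N y+20≡M) (ℤ.[+m]-[+n]≡m⊖n N M)) ⟩
    ∣ N ⊖ M ∣                       ≤⟨ ℤ.∣m⊝n∣≤m⊔n N M ⟩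
    N ℕ.⊔ M                         ≤⟨ ℕ.⊔-lub N≤W M≤W ⟩
    W                               ∎
    where
    open ℕ.≤-Reasoning
    shift : ∀ x y k → x - y ≡ (x + k) - (y + k)
    shift = solve-∀

  BaseAtMost : ℕ → Mark → Set
  BaseAtMost m (mid B _) = B ℕ.≤ m
  BaseAtMost m (end _)   = ⊤

  marks-bases : ∀ {m} E bs → All ((ℕ._≤ m) ∘ Block.base) bs → All (BaseAtMost m) (marks E bs)
  marks-bases E []                 []            = []
  marks-bases E (block B p q ∷ bs) (B≤m ∷ bases) = B≤m ∷ tt ∷ marks-bases (E + + p - + q) bs bases

  mark-within : ∀ {m} x → BaseAtMost m x → Small x → Within (m ℕ.* 16 ℕ.+ 40) (value x)
  mark-within {m} (mid B c) B≤m c-small with bounded⇒within {c} c-small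
  ... | N , c+20≡N , N≤40 =
    B ℕ.* 16 ℕ.+ N ,
    trans (ℤ.+-assoc (+ (B ℕ.* 16)) c (+ 20))
          (trans (cong (_+_ (+ (B ℕ.* 16))) c+20≡N) (sym (ℤ.pos-+ (B ℕ.* 16) N))) ,
    ℕ.+-mono-≤ (ℕ.*-monoˡ-≤ 16 B≤m) N≤40
  mark-within {m} (end e) _ e-small with bounded⇒within {e} e-small
  ... | N , e+20≡N , N≤40 = N , e+20≡N , ℕ.≤-trans N≤40 (ℕ.m≤n+m 40 (m ℕ.* 16))

  allPairs-from-all : ∀ {A : Set} {P : A → Set} {R : A → A → Set} → (∀ {x y} → P x → P y → R x y) →
    ∀ {xs} → All P xs → AllPairs R xs
  allPairs-from-all r []         = []
  allPairs-from-all r (px ∷ pxs) = All.map (r px) pxs ∷ allPairs-from-all r pxs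

  SimpleAbove : ℕ → List ℤ → Set
  SimpleAbove W xs = ∀ v .{{_ : NonZero v}} → W ℕ.< v → SimpleMod v xs

  signed-distance : ∀ σ x y → ∣ signed σ x - signed σ y ∣ ≡ ∣ x - y ∣
  signed-distance true  x y = refl
  signed-distance false x y = trans (cong ∣_∣ (negate x y)) (ℤ.∣-i∣≡∣i∣ (x - y))
    where
    negate : ∀ x y → - x - - y ≡ - (x - y)
    negate = solve-∀

  ∣signed∣ : ∀ σ x → ∣ signed σ x ∣ ≡ ∣ x ∣
  ∣signed∣ true  x = refl
  ∣signed∣ false x = ℤ.∣-i∣≡∣i∣ x

  signed-injective : ∀ σ {x y} → signed σ x ≡ signed σ y → x ≡ y
  signed-injective true  eq = eq
  signed-injective false eq = ℤ.neg-injective eq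

  line-simple : ∀ σ {m} bs → All ((ℕ._≤ m) ∘ Block.base) bs →
    AllPairs Apart (marks (+ 0) bs) → All Small (marks (+ 0) bs) → SimpleAbove (m ℕ.* 16 ℕ.+ 40) (line σ bs)
  line-simple σ {m} bs bases apart small v W<v rewrite partialSums-line σ bs =
    residues-unique (AllPairs.map⁺ (AllPairs.map separated (AllPairs.zip (apart , close))))
    where
    ms = marks (+ 0) bs
    W = m ℕ.* 16 ℕ.+ 40
    close : AllPairs (λ x y → ∣ value x - value y ∣ ℕ.≤ W) ms
    close = allPairs-from-all (λ {x} {y} → within-close {x = value x} {y = value y})
              (All.zipWith (λ (b , s) → mark-within _ b s) (marks-bases (+ 0) bs bases , small))
    separated : ∀ {x y} → Apart x y × ∣ value x - value y ∣ ℕ.≤ W →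
      signed σ (value x) ≢ signed σ (value y) × ∣ signed σ (value x) - signed σ (value y) ∣ ℕ.< v
    separated {x} {y} (x#y , x~y) =
      apart⇒value≢ x y x#y ∘ signed-injective σ ,
      ℕ.≤-<-trans (ℕ.≤-reflexive (signed-distance σ (value x) (value y))) (ℕ.≤-<-trans x~y W<v)

  Admissible : List Block → Set
  Admissible bs = drift bs ≡ + 0 × AllPairs Apart (marks (+ 0) bs) × All Small (marks (+ 0) bs)

  admissible? : ∀ bs → Dec (Admissible bs)
  admissible? bs =
    (drift bs ℤ.≟ + 0) ×-dec allPairs? apart? (marks (+ 0) bs) ×-dec all? small? (marks (+ 0) bs)

  record IsHeffterLine (k W : ℕ) (xs : List ℤ) : Set where
    field
      length≡ : length xs ≡ k
      sum≡0   : sumℤ xs ≡ + 0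
      simple  : SimpleAbove W xs

  admissible-line : ∀ σ {m} bs → All ((ℕ._≤ m) ∘ Block.base) bs → Admissible bs →
    IsHeffterLine (length bs ℕ.* 2) (m ℕ.* 16 ℕ.+ 40) (line σ bs)
  admissible-line σ bs bases (drift≡0 , apart , small) = record
    { length≡ = length-line σ bs
    ; sum≡0   = trans (sum-line σ bs) (trans (cong (signed σ) drift≡0) (signed-0 σ))
    ; simple  = line-simple σ bs bases apart small
    }

module Construction where

  open import Data.Bool using (true; false; if_then_else_)
  open import Data.Nat as ℕ using (ℕ; suc; _+_; _*_; _∸_; _≤_; _<_; _<ᵇ_; _≡ᵇ_; z≤n; s≤s; NonZero)
  import Data.Nat.Properties as ℕ
  open import Data.Nat.DivMod using (_%_; _/_; m<n⇒m%n≡m; [m+n]%n≡m%n; m%n<n; m<n*o⇒m/o<n)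
  import Data.Nat.Tactic.RingSolver as ℕ
  open import Data.Integer as ℤ using (ℤ; +_; _-_; ∣_∣)
  import Data.Integer.Properties as ℤ
  open import Data.Integer.DivMod using (_%ℕ_)
  open import Data.Integer.Divisibility.Signed using (_∣_)
  open import Data.Integer.Tactic.RingSolver using (solve-∀)
  open import Data.Fin using (Fin; toℕ)
  open import Data.Fin.Properties using (toℕ<n; toℕ-injective)
  open import Data.List using (List; []; _++_; map; concat; concatMap; mapMaybe; applyUpTo; upTo; fromMaybe; allFin)
  open import Data.List.Properties using (concatMap-map; length-map)
  open import Data.List.Relation.Unary.All as All using (All; all?)
  open import Data.List.Relation.Unary.All.Properties as All using (applyUpTo⁻)
  open import Data.Maybe using (Maybe; just; nothing)
  open import Data.Product using (Σ-syntax; _×_; _,_; proj₁; proj₂)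
  open import Data.Product.Properties using (≡-dec)
  open import Function using (_∘_; id)
  open import Relation.Binary.PropositionalEquality
  open import Relation.Nullary using (contradiction; Dec; _×-dec_)
  open import Relation.Nullary.Decidable using (from-yes)

  open CyclicWindows
  open Residues
  open BlockLines

  offset : ℕ → ℕ → ℕ → ℕ
  offset 0 0 0 = 13
  offset 0 0 1 = 11
  offset 0 1 0 = 9
  offset 0 1 1 = 16
  offset 1 0 0 = 6
  offset 1 0 1 = 5
  offset 1 1 0 = 15
  offset 1 1 1 = 4
  offset 2 0 0 = 1
  offset 2 0 1 = 8
  offset 2 1 0 = 3
  offset 2 1 1 = 2
  offset 3 0 0 = 14
  offset 3 0 1 = 10
  offset 3 1 0 = 7
  offset 3 1 1 = 12
  offset _ _ _ = 0

  decode : ℕ → ℕ × ℕ × ℕ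
  decode 13 = 0 , 0 , 0
  decode 11 = 0 , 0 , 1
  decode 9  = 0 , 1 , 0
  decode 16 = 0 , 1 , 1
  decode 6  = 1 , 0 , 0
  decode 5  = 1 , 0 , 1
  decode 15 = 1 , 1 , 0
  decode 4  = 1 , 1 , 1
  decode 1  = 2 , 0 , 0
  decode 8  = 2 , 0 , 1
  decode 3  = 2 , 1 , 0
  decode 2  = 2 , 1 , 1
  decode 14 = 3 , 0 , 0
  decode 10 = 3 , 0 , 1
  decode 7  = 3 , 1 , 0
  decode 12 = 3 , 1 , 1
  decode _  = 0 , 0 , 0

  OffsetValid : ℕ → ℕ → ℕ → Set
  OffsetValid t a b = 1 ≤ offset t a b × offset t a b ≤ 16 × decode (offset t a b) ≡ (t , a , b)

  offset-valid : ∀ {t a b} → t < 4 → a < 2 → b < 2 → OffsetValid t a b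
  offset-valid t<4 a<2 b<2 = applyUpTo⁻ id 2 (applyUpTo⁻ id 2 (applyUpTo⁻ id 4 table t<4) a<2) b<2
    where
    valid? : ∀ t a b → Dec (OffsetValid t a b)
    valid? t a b = (1 ℕ.≤? offset t a b) ×-dec (offset t a b ℕ.≤? 16) ×-dec
                   ≡-dec ℕ._≟_ (≡-dec ℕ._≟_ ℕ._≟_) (decode (offset t a b)) (t , a , b)
    table : All (λ t → All (λ a → All (OffsetValid t a) (upTo 2)) (upTo 2)) (upTo 4)
    table = from-yes (all? (λ t → all? (λ a → all? (valid? t a) (upTo 2)) (upTo 2)) (upTo 4))

  magnitude-injective : ∀ {I I′ o o′} → 1 ≤ o → o ≤ 16 → 1 ≤ o′ → o′ ≤ 16 →
    I * 16 + o ≡ I′ * 16 + o′ → I ≡ I′ × o ≡ o′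
  magnitude-injective {I} {I′} {suc r} {suc r′} (s≤s z≤n) (s≤s r≤15) (s≤s z≤n) (s≤s r′≤15) eq =
    ℕ.*-cancelʳ-≡ I I′ 16 (ℕ.+-cancelʳ-≡ (suc r) (I * 16) (I′ * 16) (trans eq (cong (_+_ (I′ * 16)) (sym o≡o′)))) ,
    o≡o′
    where
    [1+r]-[1+r′]≡r-r′ : + suc r - + suc r′ ≡ + r - + r′
    [1+r]-[1+r′]≡r-r′ = trans (ℤ.[+m]-[+n]≡m⊖n (suc r) (suc r′))
                          (trans (ℤ.[1+m]⊖[1+n]≡m⊖n r r′) (sym (ℤ.[+m]-[+n]≡m⊖n r r′)))
    o≡o′ : suc r ≡ suc r′
    o≡o′ = ℤ.+-injective (≡mod∧close⇒≡ {x = + suc r} {+ suc r′}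
             (mid-value-≡⇒≡mod16 {I} {I′} {+ suc r} {+ suc r′}
               (trans (sym (ℤ.pos-+ (I * 16) (suc r))) (trans (cong +_ eq) (ℤ.pos-+ (I′ * 16) (suc r′)))))
             (subst (_< 16) (cong ∣_∣ (sym [1+r]-[1+r′]≡r-r′)) (∣+a-+b∣<n (s≤s r≤15) (s≤s r′≤15))))

  blockEntry : ℕ → ℕ → ℕ → ℕ → Maybe ℤ
  blockEntry I t a b = if t <ᵇ 4 then just (signed (a ≡ᵇ b) (+ (I * 16 + offset t a b))) else nothing

  rowPair : ℕ → ℕ → ℕ → List ℤ
  rowPair I a t = fromMaybe (blockEntry I t a 0) ++ fromMaybe (blockEntry I t a 1)

  colPair : ℕ → ℕ → ℕ → List ℤ
  colPair b I t = fromMaybe (blockEntry I t 0 b) ++ fromMaybe (blockEntry I t 1 b)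

  rowBlock : ℕ → ℕ → ℕ → Block
  rowBlock I a t = block I (offset t a 0) (offset t a 1)

  colBlock : (ℕ → ℕ) → ℕ → ℕ → Block
  colBlock β b u = block (β u) (offset (3 ∸ u) 0 b) (offset (3 ∸ u) 1 b)

  -- Both checks run by evaluation even for symbolic I and β, since admissibility never inspects the bases.
  rowBlocks-admissible : ∀ I →
    All (λ a → All (λ k → Admissible (map (rowBlock I a) (rotate 4 k))) (upTo 5)) (upTo 2)
  rowBlocks-admissible I =
    from-yes (all? (λ a → all? (λ k → admissible? (map (rowBlock I a) (rotate 4 k))) (upTo 5)) (upTo 2))

  colBlocks-admissible : ∀ β →
    All (λ b → All (λ k → Admissible (map (colBlock β b) (rotate 4 k))) (upTo 5)) (upTo 2)
  colBlocks-admissible β =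
    from-yes (all? (λ b → all? (λ k → admissible? (map (colBlock β b) (rotate 4 k))) (upTo 5)) (upTo 2))

  blockEntry-outside : ∀ I {t} a b → 4 ≤ t → blockEntry I t a b ≡ nothing
  blockEntry-outside I {t} a b 4≤t with t <ᵇ 4 | ℕ.<ᵇ⇒< t 4
  ... | false | _   = refl
  ... | true  | t<4 = contradiction (t<4 _) (ℕ.≤⇒≯ 4≤t)

  blockEntry-inside : ∀ I {t} a b → t < 4 →
    blockEntry I t a b ≡ just (signed (a ≡ᵇ b) (+ (I * 16 + offset t a b)))
  blockEntry-inside I {t} a b t<4 with t <ᵇ 4 | ℕ.<⇒<ᵇ t<4
  ... | true | _ = refl

  rowPair-outside : ∀ I a {t} → 4 ≤ t → rowPair I a t ≡ []
  rowPair-outside I a 4≤t rewrite blockEntry-outside I a 0 4≤t | blockEntry-outside I a 1 4≤t = refl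

  colPair-outside : ∀ b I {t} → 4 ≤ t → colPair b I t ≡ []
  colPair-outside b I 4≤t rewrite blockEntry-outside I 0 b 4≤t | blockEntry-outside I 1 b 4≤t = refl

  rowPair-inside : ∀ I {a t} → a < 2 → t < 4 → rowPair I a t ≡ pair (a ≡ᵇ 0) (rowBlock I a t)
  rowPair-inside I {0} _ t<4 rewrite blockEntry-inside I 0 0 t<4 | blockEntry-inside I 0 1 t<4 = refl
  rowPair-inside I {1} _ t<4 rewrite blockEntry-inside I 1 0 t<4 | blockEntry-inside I 1 1 t<4 = refl
  rowPair-inside I {suc (suc _)} (s≤s (s≤s ())) _

  colPair-inside : ∀ {b} I t → b < 2 → t < 4 →
    colPair b I t ≡ pair (b ≡ᵇ 0) (block I (offset t 0 b) (offset t 1 b))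
  colPair-inside {0} I t _ t<4 rewrite blockEntry-inside I 0 0 t<4 | blockEntry-inside I 1 0 t<4 = refl
  colPair-inside {1} I t _ t<4 rewrite blockEntry-inside I 0 1 t<4 | blockEntry-inside I 1 1 t<4 = refl
  colPair-inside {suc (suc _)} I t (s≤s (s≤s ())) _

  blockEntry-just : ∀ I t a b {x} → blockEntry I t a b ≡ just x → t < 4 × ∣ x ∣ ≡ I * 16 + offset t a b
  blockEntry-just I t a b eq with t <ᵇ 4 | ℕ.<ᵇ⇒< t 4
  blockEntry-just I t a b refl | true | t<4 = t<4 _ , ∣signed∣ (a ≡ᵇ b) (+ (I * 16 + offset t a b))

  module Circulant (m : ℕ) .{{_ : NonZero m}} (4≤m : 4 ≤ m) where

    diagonal : ℕ → ℕ → ℕ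
    diagonal I J = (+ J - + I) %ℕ m

    diagonal-% : ∀ a b → diagonal (a % m) (b % m) ≡ (+ b - + a) %ℕ m
    diagonal-% a b = [a%m-b%m]%m≡[a-b]%m b a

    diagonal-row : ∀ {I u} → I < m → u < m → diagonal I ((I + u) % m) ≡ u
    diagonal-row {I} {u} I<m u<m = begin
      diagonal I ((I + u) % m)            ≡⟨ cong (λ i → diagonal i ((I + u) % m)) (sym (m<n⇒m%n≡m I<m)) ⟩
      diagonal (I % m) ((I + u) % m)      ≡⟨ diagonal-% I (I + u) ⟩
      (+ (I + u) - + I) %ℕ m              ≡⟨ cong (_%ℕ m) (trans (ℤ.[+m]-[+n]≡m⊖n (I + u) I) (ℤ.≤-⊖ (ℕ.m≤m+n I u))) ⟩
      (I + u ∸ I) % m                     ≡⟨ cong (_% m) (ℕ.m+n∸m≡n I u) ⟩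
      u % m                               ≡⟨ m<n⇒m%n≡m u<m ⟩
      u                                   ∎
      where open ≡-Reasoning

    -- Column J meets its four filled blocks in the rows colBase J u, u < 4, which lie on diagonal 3 ∸ u.
    colStart : ℕ → ℕ
    colStart J = (J + (m ∸ 3)) % m

    colStart-+3 : ∀ {J} → J < m → (colStart J + 3) % m ≡ J
    colStart-+3 {J} J<m = begin
      ((J + (m ∸ 3)) % m + 3) % m     ≡⟨ [m%d+n]%d≡[m+n]%d (J + (m ∸ 3)) 3 m ⟩
      (J + (m ∸ 3) + 3) % m           ≡⟨ cong (_% m) (trans (ℕ.+-assoc J (m ∸ 3) 3) (cong (_+_ J) (ℕ.m∸n+n≡m 3≤m))) ⟩
      (J + m) % m                     ≡⟨ [m+n]%n≡m%n J m ⟩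
      J % m                           ≡⟨ m<n⇒m%n≡m J<m ⟩
      J                               ∎
      where
      open ≡-Reasoning
      3≤m = ℕ.≤-trans (ℕ.n≤1+n 3) 4≤m

    colBase : ℕ → ℕ → ℕ
    colBase J u = (colStart J + u) % m

    diagonal-col : ∀ {J} u → J < m → diagonal (colBase J u) J ≡ (+ 3 - + u) %ℕ m
    diagonal-col {J} u J<m = begin
      diagonal ((s + u) % m) J              ≡⟨ cong (diagonal ((s + u) % m)) (sym (colStart-+3 J<m)) ⟩
      diagonal ((s + u) % m) ((s + 3) % m)  ≡⟨ diagonal-% (s + u) (s + 3) ⟩
      (+ (s + 3) - + (s + u)) %ℕ m          ≡⟨ cong (_%ℕ m) (trans (cong₂ _-_ (ℤ.pos-+ s 3) (ℤ.pos-+ s u))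
                                                                    (cancel (+ s) (+ u) (+ 3))) ⟩
      (+ 3 - + u) %ℕ m                      ∎
      where
      open ≡-Reasoning
      s = colStart J
      cancel : ∀ s a b → (s ℤ.+ b) - (s ℤ.+ a) ≡ b - a
      cancel = solve-∀

    diagonal-injective : ∀ {I J J′} → J < m → J′ < m → diagonal I J ≡ diagonal I J′ → J ≡ J′
    diagonal-injective {I} {J} {J′} J<m J′<m eq = ℤ.+-injective (≡mod∧close⇒≡ {x = + J} {+ J′} J≡J′ close)
      where
      cancel : ∀ j j′ i → (j - i) - (j′ - i) ≡ j - j′
      cancel = solve-∀
      J≡J′ : + J ≡ + J′ mod m
      J≡J′ = subst (+ m ∣_) (cancel (+ J) (+ J′) (+ I)) (%ℕ-≡⇒≡mod (+ J - + I) (+ J′ - + I) eq)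
      close : ∣ + J - + J′ ∣ < m
      close = ∣+a-+b∣<n J<m J′<m

    entry : ℕ → ℕ → Maybe ℤ
    entry c d = blockEntry (c / 2) (diagonal (c / 2) (d / 2)) (c % 2) (d % 2)

    array : PArray (m * 2)
    array i j = entry (toℕ i) (toℕ j)

    entry-col : ∀ c {b} J → b < 2 → entry c (b + J * 2) ≡ blockEntry (c / 2) (diagonal (c / 2) J) (c % 2) b
    entry-col c {b} J b<2 = cong₂ (λ J′ b′ → blockEntry (c / 2) (diagonal (c / 2) J′) (c % 2) b′)
      ([a+I*n]/n≡I J b<2) ([a+I*n]%n≡a J b<2)

    entry-row : ∀ {a} I d → a < 2 → entry (a + I * 2) d ≡ blockEntry I (diagonal I (d / 2)) a (d % 2)
    entry-row {a} I d a<2 = cong₂ (λ I′ a′ → blockEntry I′ (diagonal I′ (d / 2)) a′ (d % 2))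
      ([a+I*n]/n≡I I a<2) ([a+I*n]%n≡a I a<2)

    row-array : ∀ c →
      mapMaybe (entry c ∘ toℕ) (allFin (m * 2)) ≡ concat (applyUpTo (rowPair (c / 2) (c % 2) ∘ diagonal (c / 2)) m)
    row-array c = begin
      mapMaybe (entry c ∘ toℕ) (allFin (m * 2))
        ≡⟨ mapMaybe-allFin (entry c) (m * 2) ⟩
      concat (applyUpTo (fromMaybe ∘ entry c) (m * 2))
        ≡⟨ concat-applyUpTo-*2 (fromMaybe ∘ entry c) m ⟩
      concat (applyUpTo (λ J → fromMaybe (entry c (J * 2)) ++ fromMaybe (entry c (suc (J * 2)))) m)
        ≡⟨ cong concat (applyUpTo-cong m (λ {J} _ → cong₂ (λ x y → fromMaybe x ++ fromMaybe y)
             (entry-col c J (s≤s z≤n)) (entry-col c J (s≤s (s≤s z≤n))))) ⟩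
      concat (applyUpTo (rowPair (c / 2) (c % 2) ∘ diagonal (c / 2)) m) ∎
      where open ≡-Reasoning

    col-array : ∀ d →
      mapMaybe ((λ c → entry c d) ∘ toℕ) (allFin (m * 2)) ≡ concat (applyUpTo (λ I → colPair (d % 2) I (diagonal I (d / 2))) m)
    col-array d = begin
      mapMaybe ((λ c → entry c d) ∘ toℕ) (allFin (m * 2))
        ≡⟨ mapMaybe-allFin (λ c → entry c d) (m * 2) ⟩
      concat (applyUpTo (fromMaybe ∘ (λ c → entry c d)) (m * 2))
        ≡⟨ concat-applyUpTo-*2 (fromMaybe ∘ (λ c → entry c d)) m ⟩
      concat (applyUpTo (λ I → fromMaybe (entry (I * 2) d) ++ fromMaybe (entry (suc (I * 2)) d)) m)
        ≡⟨ cong concat (applyUpTo-cong m (λ {I} _ → cong₂ (λ x y → fromMaybe x ++ fromMaybe y)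
             (entry-row I d (s≤s z≤n)) (entry-row I d (s≤s (s≤s z≤n))))) ⟩
      concat (applyUpTo (λ I → colPair (d % 2) I (diagonal I (d / 2))) m) ∎
      where open ≡-Reasoning

    W : ℕ
    W = m * 16 + 40

    rotated-heffter : ∀ σ (f : ℕ → Block) {k} → k ≤ 4 → All ((_≤ m) ∘ Block.base) (map f (rotate 4 k)) →
      Admissible (map f (rotate 4 k)) → IsHeffterLine 8 W (concatMap (pair σ ∘ f) (rotate 4 k))
    rotated-heffter σ f {k} k≤4 bases admissible =
      subst₂ (λ l xs → IsHeffterLine (l * 2) W xs)
        (trans (length-map f (rotate 4 k)) (length-rotate k≤4))
        (concatMap-map (pair σ) f (rotate 4 k))
        (admissible-line σ (map f (rotate 4 k)) bases admissible)

    row-heffter : ∀ {I a} → I < m → a < 2 → IsHeffterLine 8 W (concat (applyUpTo (rowPair I a ∘ diagonal I) m))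
    row-heffter {I} {a} I<m a<2 =
      heffter (window 4 I (rowPair I a ∘ diagonal I) (pair σ ∘ rowBlock I a) 4≤m (ℕ.<⇒≤ I<m) outside inside)
      where
      σ = a ≡ᵇ 0
      outside : ∀ {u} → 4 ≤ u → u < m → rowPair I a (diagonal I ((I + u) % m)) ≡ []
      outside 4≤u u<m = trans (cong (rowPair I a) (diagonal-row I<m u<m)) (rowPair-outside I a 4≤u)
      inside : ∀ {u} → u < 4 → rowPair I a (diagonal I ((I + u) % m)) ≡ pair σ (rowBlock I a u)
      inside u<4 = trans (cong (rowPair I a) (diagonal-row I<m (ℕ.<-≤-trans u<4 4≤m))) (rowPair-inside I a<2 u<4)
      heffter : Σ[ k ∈ ℕ ] k ≤ 4 ×
                  concat (applyUpTo (rowPair I a ∘ diagonal I) m) ≡ concatMap (pair σ ∘ rowBlock I a) (rotate 4 k) →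
        IsHeffterLine 8 W (concat (applyUpTo (rowPair I a ∘ diagonal I) m))
      heffter (k , k≤4 , eq) = subst (IsHeffterLine 8 W) (sym eq)
        (rotated-heffter σ (rowBlock I a) k≤4
          (All.map⁺ (All.universal (λ _ → ℕ.<⇒≤ I<m) (rotate 4 k)))
          (applyUpTo⁻ id 5 (applyUpTo⁻ id 2 (rowBlocks-admissible I) a<2) (s≤s k≤4)))

    col-heffter : ∀ {J b} → J < m → b < 2 → IsHeffterLine 8 W (concat (applyUpTo (λ I → colPair b I (diagonal I J)) m))
    col-heffter {J} {b} J<m b<2 =
      heffter (window 4 (colStart J) f (pair σ ∘ colBlock (colBase J) b) 4≤m (ℕ.<⇒≤ (m%n<n _ m)) outside inside)
      where
      σ = b ≡ᵇ 0
      f = λ I → colPair b I (diagonal I J)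
      3<m = ℕ.<-≤-trans (ℕ.n<1+n 3) 4≤m
      outside : ∀ {u} → 4 ≤ u → u < m → f (colBase J u) ≡ []
      outside {u} 4≤u u<m = begin
        colPair b (colBase J u) (diagonal (colBase J u) J)  ≡⟨ cong (colPair b (colBase J u)) (diagonal-col u J<m) ⟩
        colPair b (colBase J u) ((+ 3 - + u) %ℕ m)          ≡⟨ cong (colPair b (colBase J u)) (a<b⇒[a-b]%m≡a+m∸b 4≤u u<m) ⟩
        colPair b (colBase J u) (3 + m ∸ u)
          ≡⟨ colPair-outside b (colBase J u) (ℕ.m+n≤o⇒m≤o∸n 4 (ℕ.+-monoʳ-≤ 3 u<m)) ⟩
        [] ∎
        where open ≡-Reasoning
      inside : ∀ {u} → u < 4 → f (colBase J u) ≡ pair σ (colBlock (colBase J) b u)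
      inside {u} u<4 = begin
        colPair b (colBase J u) (diagonal (colBase J u) J)  ≡⟨ cong (colPair b (colBase J u)) (diagonal-col u J<m) ⟩
        colPair b (colBase J u) ((+ 3 - + u) %ℕ m)
          ≡⟨ cong (colPair b (colBase J u)) (b≤a⇒[a-b]%m≡a∸b (ℕ.≤-pred u<4) 3<m) ⟩
        colPair b (colBase J u) (3 ∸ u)
          ≡⟨ colPair-inside (colBase J u) (3 ∸ u) b<2 (s≤s (ℕ.m∸n≤m 3 u)) ⟩
        pair σ (colBlock (colBase J) b u) ∎
        where open ≡-Reasoning
      heffter : Σ[ k ∈ ℕ ] k ≤ 4 × concat (applyUpTo f m) ≡ concatMap (pair σ ∘ colBlock (colBase J) b) (rotate 4 k) →
        IsHeffterLine 8 W (concat (applyUpTo f m))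
      heffter (k , k≤4 , eq) = subst (IsHeffterLine 8 W) (sym eq)
        (rotated-heffter σ (colBlock (colBase J) b) k≤4
          (All.map⁺ (All.universal (λ u → ℕ.<⇒≤ (m%n<n (colStart J + u) m)) (rotate 4 k)))
          (applyUpTo⁻ id 5 (applyUpTo⁻ id 2 (colBlocks-admissible (colBase J)) b<2) (s≤s k≤4)))

    half<m : ∀ (i : Fin (m * 2)) → toℕ i / 2 < m
    half<m i = m<n*o⇒m/o<n {toℕ i} {m} {2} (toℕ<n i)

    array-row : ∀ i → IsHeffterLine 8 W (row array i)
    array-row i = subst (IsHeffterLine 8 W) (sym (row-array (toℕ i)))
      (row-heffter (half<m i) (m%n<n (toℕ i) 2))

    array-col : ∀ j → IsHeffterLine 8 W (col array j)
    array-col j = subst (IsHeffterLine 8 W) (sym (col-array (toℕ j)))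
      (col-heffter (half<m j) (m%n<n (toℕ j) 2))


    entry-magnitude : ∀ {c d x} → entry c d ≡ just x →
      Σ[ o ∈ ℕ ] ∣ x ∣ ≡ c / 2 * 16 + o × 1 ≤ o × o ≤ 16 × decode o ≡ (diagonal (c / 2) (d / 2) , c % 2 , d % 2)
    entry-magnitude {c} {d} eq with blockEntry-just (c / 2) (diagonal (c / 2) (d / 2)) (c % 2) (d % 2) eq
    ... | t<4 , ∣x∣≡ = _ , ∣x∣≡ , offset-valid t<4 (m%n<n c 2) (m%n<n d 2)

    array-entries : ∀ i j x → array i j ≡ just x → x ≢ + 0 × ∣ x ∣ ≤ m * 2 * 8
    array-entries i j x eq with entry-magnitude {toℕ i} {toℕ j} eq
    ... | o , ∣x∣≡ , 1≤o , o≤16 , _ = nonzero , bounded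
      where
      I = toℕ i / 2
      nonzero : x ≢ + 0
      nonzero refl = ℕ.<⇒≢ (ℕ.<-≤-trans 1≤o (ℕ.m≤n+m o (I * 16))) ∣x∣≡
      bounded : ∣ x ∣ ≤ m * 2 * 8
      bounded = begin
        ∣ x ∣          ≡⟨ ∣x∣≡ ⟩
        I * 16 + o     ≤⟨ ℕ.+-monoʳ-≤ (I * 16) o≤16 ⟩
        I * 16 + 16    ≡⟨ ℕ.+-comm (I * 16) 16 ⟩
        suc I * 16     ≤⟨ ℕ.*-monoˡ-≤ 16 (half<m i) ⟩
        m * 16         ≡⟨ ℕ.*-assoc m 2 8 ⟨
        m * 2 * 8      ∎
        where open ℕ.≤-Reasoning

    array-absInj : ∀ i j i′ j′ x y → array i j ≡ just x → array i′ j′ ≡ just y →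
      ∣ x ∣ ≡ ∣ y ∣ → i ≡ i′ × j ≡ j′
    array-absInj i j i′ j′ x y ex ey ∣x∣≡∣y∣
      with entry-magnitude {toℕ i} {toℕ j} ex | entry-magnitude {toℕ i′} {toℕ j′} ey
    ... | o , ∣x∣≡ , 1≤o , o≤16 , decode-o | o′ , ∣y∣≡ , 1≤o′ , o′≤16 , decode-o′ =
      toℕ-injective (%-/-injective (cong (proj₁ ∘ proj₂) cell≡) I≡I′) ,
      toℕ-injective (%-/-injective (cong (proj₂ ∘ proj₂) cell≡) J≡J′)
      where
      magnitudes = magnitude-injective 1≤o o≤16 1≤o′ o′≤16 (trans (sym ∣x∣≡) (trans ∣x∣≡∣y∣ ∣y∣≡))
      I≡I′ = proj₁ magnitudes
      cell≡ = trans (sym decode-o) (trans (cong decode (proj₂ magnitudes)) decode-o′)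
      J≡J′ = diagonal-injective {toℕ i / 2} (half<m j) (half<m j′)
               (trans (cong proj₁ cell≡) (cong (λ I → diagonal I (toℕ j′ / 2)) (sym I≡I′)))

    W<2nk+1 : W < suc (2 * (m * 2) * 8)
    W<2nk+1 = s≤s (begin
      m * 16 + 40       ≤⟨ ℕ.+-monoʳ-≤ (m * 16) (ℕ.≤-trans (ℕ.m≤m+n 40 24) (ℕ.*-monoˡ-≤ 16 4≤m)) ⟩
      m * 16 + m * 16   ≡⟨ double m ⟩
      2 * (m * 2) * 8   ∎)
      where
      open ℕ.≤-Reasoning
      double : ∀ m → m * 16 + m * 16 ≡ 2 * (m * 2) * 8
      double = ℕ.solve-∀

    isSHstar : IsSHstar (m * 2) 8 array
    isSHstar = record
      { isH = record
        { entries  = array-entries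
        ; absInj   = array-absInj
        ; rowCount = IsHeffterLine.length≡ ∘ array-row
        ; colCount = IsHeffterLine.length≡ ∘ array-col
        ; rowSum   = IsHeffterLine.sum≡0 ∘ array-row
        ; colSum   = IsHeffterLine.sum≡0 ∘ array-col
        }
      ; rowSimple₁ = λ i → IsHeffterLine.simple (array-row i) _ W<2nk+1
      ; rowSimple₂ = λ i → IsHeffterLine.simple (array-row i) _ (ℕ.<-trans W<2nk+1 (ℕ.n<1+n _))
      ; colSimple₁ = λ j → IsHeffterLine.simple (array-col j) _ W<2nk+1
      ; colSimple₂ = λ j → IsHeffterLine.simple (array-col j) _ (ℕ.<-trans W<2nk+1 (ℕ.n<1+n _))
      }

open import Data.Nat using (ℕ; _≤_)
open import Data.Nat.Divisibility using (_∣_)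
open import Data.Product using (Σ)
open import Data.Nat as ℕ using (z≤n; s≤s; >-nonZero)
import Data.Nat.Properties as ℕ
open import Data.Nat.Divisibility using (divides)
open import Data.Product using (_,_)
open import Relation.Binary.PropositionalEquality using (refl)
open Construction

proposition4p6 : (n : ℕ) → 8 ≤ n → 2 ∣ n → Σ (PArray n) (IsSHstar n 8)
proposition4p6 .(m ℕ.* 2) 8≤n (divides m refl) = array , isSHstar
  where
  4≤m : 4 ≤ m
  4≤m = ℕ.*-cancelʳ-≤ 4 m 2 8≤n
  open Circulant m {{>-nonZero (ℕ.<-≤-trans (s≤s z≤n) 4≤m)}} 4≤m
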